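{- For all integers $n>k\ge 0$, \[ S(n,k)=\binom{n}{k}\sum_{\ell=1}^{n-k}(-1)^{\ell}\frac{\binom{k}{\ell}}{\binom{n-k+\ell}{n-k}}\sum_{i=0}^{\ell}(-1)^{i}\binom{n-k+\ell}{\ell-i}S(n-k+i,i) \] and \[ S(n,k)=(-1)^n\sum_{i=2k-n}^{k-1}(-1)^{i}\binom{n}{i}\binom{i-1}{2k-n-1}S(n-i,k-i). \]
   Context: $S(n,k)$ denotes the Stirling number of the second kind, i.e. the number of ways to partition an $n$-element set into $k$ nonempty subsets; equivalently $S(n,k)=\frac1{k!}\sum_{i=0}^k(-1)^i\binom{k}{i}(k-i)^n$, or $\frac{(e^x-1)^k}{k!}=\sum_{n=k}^\infty S(n,k)\frac{x^n}{n!}$ for integers $k\ge 0$. In particular $S(0,0)=1$, $S(n,0)=0$ for $n\ge1$, and $S(n,k)=0$ for $k>n$. The binomial coefficient conventions $\binom00=1$, $\binom{ -1}{ -1}=1$, and $\binom{p}{q}=0$ whenever $p\ge 0>q$ are adopted. -}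

module Defs where

open import Data.Nat as ℕ using (ℕ; zero; suc; _≤_; _<_; _>_; z≤n; s≤s; NonZero; _≤ᵇ_)
import Data.Nat.Properties as ℕP
open import Data.Nat.Combinatorics using (_C_; nCk+nC[k+1]≡[n+1]C[k+1])
open import Data.Integer as ℤ using (ℤ; +_; -[1+_]; -1ℤ)
open import Data.Rational as ℚ using (ℚ)
open import Data.Bool using (if_then_else_)
open import Relation.Binary.PropositionalEquality using (subst)

S : ℕ → ℕ → ℕ
S zero    zero    = 1
S zero    (suc k) = 0
S (suc n) zero    = 0
S (suc n) (suc k) = suc k ℕ.* S n (suc k) ℕ.+ S n k

sumℤ : ℕ → (ℕ → ℤ) → ℤ
sumℤ zero    f = + 0
sumℤ (suc m) f = sumℤ m f ℤ.+ f m

sumℚ : ℕ → (ℕ → ℚ) → ℚ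
sumℚ zero    f = ℚ.0ℚ
sumℚ (suc m) f = sumℚ m f ℚ.+ f m

sumℤ-range : ℤ → ℤ → (ℤ → ℤ) → ℤ
sumℤ-range a b f = sumℤ (ℤ.∣ (b ℤ.- a) ℤ.+ + 1 ∣) (λ j → f (a ℤ.+ + j))

sgn : ℤ → ℤ
sgn i = -1ℤ ℤ.^ ℤ.∣ i ∣

-- Binomial coefficient with integer arguments (standard extension,
-- e.g. Kronenburg / Sprugnoli):
--   q ≥ 0        : binom(p,q) = p(p-1)...(p-q+1)/q!
--                  (= p C q for p ≥ 0, = (-1)^q binom(-p+q-1,q) for p < 0)
--   q < 0, p ≥ 0 : 0
--   q ≤ p < 0    : (-1)^(p-q) binom(-q-1, p-q)
--   p < q < 0    : 0
-- In particular binom(0,0)=1, binom(-1,-1)=1, binom(p,q)=0 for p ≥ 0 > q.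

binomℤ : ℤ → ℤ → ℤ
binomℤ (+ p)     (+ q)     = + (p C q)
binomℤ -[1+ a ]  (+ q)     = (-1ℤ ℤ.^ q) ℤ.* + ((a ℕ.+ q) C q)
binomℤ (+ p)     -[1+ b ]  = + 0
binomℤ -[1+ a ]  -[1+ b ]  =
  if a ≤ᵇ b then (-1ℤ ℤ.^ (b ℕ.∸ a)) ℤ.* + (b C (b ℕ.∸ a)) else + 0

C-pos : ∀ n k → k ≤ n → n C k > 0
C-pos n       zero    _       = ℕP.≤-refl
C-pos (suc n) (suc k) (s≤s k≤n) =
  subst (_> 0) (nCk+nC[k+1]≡[n+1]C[k+1] n k)
        (ℕP.<-≤-trans (C-pos n k k≤n) (ℕP.m≤m+n (n C k) (n C suc k)))

C-nonZero : ∀ m ℓ → NonZero ((m ℕ.+ ℓ) C m)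
C-nonZero m ℓ = ℕ.>-nonZero (C-pos (m ℕ.+ ℓ) m (ℕP.m≤m+n m ℓ))

ratio : ℕ → ℕ → ℕ → ℚ
ratio k ℓ m = ((+ (k C ℓ)) ℚ./ ((m ℕ.+ ℓ) C m)) {{C-nonZero m ℓ}}

-- Both identities come from the expansion
--   S(m + k, k) = Σ_l C(m + k, m + l) S₂(m, l),
-- where S₂(m, l) counts partitions of an (m + l)-set into l blocks of size at least 2.
-- Binomial inversion in k expresses S₂(m, ℓ) as (-1)^ℓ Σ_i (-1)^i C(m + ℓ, ℓ - i) S(m + i, i);
-- substituting this back with m = n - k and using trinomial revision,
-- C(n, m + ℓ) C(m + ℓ, m) = C(n, k) C(k, ℓ), gives the first identity.
-- For the second, when 2k > n write k = m + d + 1 and expand every S(n - i, k - i) = S(m + r, r).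
-- Trinomial revision turns the coefficient of S₂(m, l) into C(n, m + l) times
-- Σ_j (-1)^j C(d + 1 + p, d + 1 + j) C(d + j, d) = 1, so the sum collapses to the expansion of S(n, k).
-- When 2k ≤ n, only the term i = 0 is nonzero, and it equals (-1)^n S(n, k).

module Submission where

open import Defs
open import Data.Nat using (ℕ; suc; _<_; _∸_)
open import Data.Nat.Combinatorics using (_C_)
open import Data.Integer as ℤ using (ℤ; +_)
open import Data.Rational as ℚ using (ℚ)
open import Data.Product using (_×_)
open import Relation.Binary.PropositionalEquality using (_≡_)

open import Data.Nat as ℕ using (zero; _+_; _*_; _≤_; z≤n; s≤s; _!)
import Data.Nat.Properties as ℕ
import Data.Nat.Tactic.RingSolver as ℕ-Solver
open import Data.Nat.Combinatorics
  using (nCk+nC[k+1]≡[n+1]C[k+1]; k>n⇒nCk≡0; nCn≡1; nC1≡n; nCk≡nC[n∸k]; nCk≡n!/k![n-k]!; k![n∸k]!∣n!)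
open import Data.Nat.DivMod using (_/_; m/n*n≡m)
open import Data.Integer using (-[1+_]; -1ℤ; 0ℤ; 1ℤ)
import Data.Integer.Properties as ℤ
open import Data.Integer.Tactic.RingSolver using (solve-∀)
import Data.Rational.Properties as ℚ
open import Data.Rational.Solver using (module +-*-Solver)
open import Data.Rational.Unnormalised as ℚᵘ using (mkℚᵘ; *≡*)
import Data.Rational.Unnormalised.Properties as ℚᵘ
open import Data.Product using (_,_)
open import Data.Sum using (inj₁; inj₂)
open import Function using (_∘_)
open import Relation.Nullary using (yes; no)
open import Relation.Binary.PropositionalEquality using (refl; sym; trans; cong; cong₂; subst; module ≡-Reasoning)
open ≡-Reasoning

-- Finite sums

sumℤ-cong : ∀ L {f g : ℕ → ℤ} → (∀ i → i < L → f i ≡ g i) → sumℤ L f ≡ sumℤ L g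
sumℤ-cong zero    f≡g = refl
sumℤ-cong (suc L) f≡g = cong₂ ℤ._+_ (sumℤ-cong L (λ i i<L → f≡g i (ℕ.m<n⇒m<1+n i<L))) (f≡g L ℕ.≤-refl)

sumℤ-zero : ∀ L {f : ℕ → ℤ} → (∀ i → i < L → f i ≡ 0ℤ) → sumℤ L f ≡ 0ℤ
sumℤ-zero zero    f≡0 = refl
sumℤ-zero (suc L) f≡0 = cong₂ ℤ._+_ (sumℤ-zero L (λ i i<L → f≡0 i (ℕ.m<n⇒m<1+n i<L))) (f≡0 L ℕ.≤-refl)

sumℤ-distrib-+ : ∀ L (f g : ℕ → ℤ) → sumℤ L (λ i → f i ℤ.+ g i) ≡ sumℤ L f ℤ.+ sumℤ L g
sumℤ-distrib-+ zero    f g = refl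
sumℤ-distrib-+ (suc L) f g =
  trans (cong (ℤ._+ (f L ℤ.+ g L)) (sumℤ-distrib-+ L f g)) (interchange (sumℤ L f) (sumℤ L g) (f L) (g L))
  where
  interchange : ∀ a b c d → a ℤ.+ b ℤ.+ (c ℤ.+ d) ≡ a ℤ.+ c ℤ.+ (b ℤ.+ d)
  interchange = solve-∀

*-distribˡ-sumℤ : ∀ L c (f : ℕ → ℤ) → c ℤ.* sumℤ L f ≡ sumℤ L (λ i → c ℤ.* f i)
*-distribˡ-sumℤ zero    c f = ℤ.*-zeroʳ c
*-distribˡ-sumℤ (suc L) c f =
  trans (ℤ.*-distribˡ-+ c (sumℤ L f) (f L)) (cong (ℤ._+ c ℤ.* f L) (*-distribˡ-sumℤ L c f))

*-distribʳ-sumℤ : ∀ L c (f : ℕ → ℤ) → sumℤ L f ℤ.* c ≡ sumℤ L (λ i → f i ℤ.* c)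
*-distribʳ-sumℤ zero    c f = ℤ.*-zeroˡ c
*-distribʳ-sumℤ (suc L) c f =
  trans (ℤ.*-distribʳ-+ c (sumℤ L f) (f L)) (cong (ℤ._+ f L ℤ.* c) (*-distribʳ-sumℤ L c f))

sumℤ-suc : ∀ L (f : ℕ → ℤ) → sumℤ (suc L) f ≡ f 0 ℤ.+ sumℤ L (f ∘ suc)
sumℤ-suc zero    f = ℤ.+-comm 0ℤ (f 0)
sumℤ-suc (suc L) f = trans (cong (ℤ._+ f (suc L)) (sumℤ-suc L f)) (ℤ.+-assoc (f 0) _ _)

sumℤ-+ : ∀ a b (f : ℕ → ℤ) → sumℤ (a + b) f ≡ sumℤ a f ℤ.+ sumℤ b (λ i → f (a + i))
sumℤ-+ a zero    f = trans (cong (λ L → sumℤ L f) (ℕ.+-identityʳ a)) (sym (ℤ.+-identityʳ _))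
sumℤ-+ a (suc b) f = begin
  sumℤ (a + suc b) f                                   ≡⟨ cong (λ L → sumℤ L f) (ℕ.+-suc a b) ⟩
  sumℤ (a + b) f ℤ.+ f (a + b)                         ≡⟨ cong (ℤ._+ f (a + b)) (sumℤ-+ a b f) ⟩
  sumℤ a f ℤ.+ sumℤ b (λ i → f (a + i)) ℤ.+ f (a + b)  ≡⟨ ℤ.+-assoc (sumℤ a f) _ _ ⟩
  sumℤ a f ℤ.+ sumℤ (suc b) (λ i → f (a + i))          ∎

sumℤ-swap : ∀ L M (f : ℕ → ℕ → ℤ) →
            sumℤ L (λ i → sumℤ M (f i)) ≡ sumℤ M (λ t → sumℤ L (λ i → f i t))
sumℤ-swap zero    M f = sym (sumℤ-zero M (λ _ _ → refl))
sumℤ-swap (suc L) M f =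
  trans (cong (ℤ._+ sumℤ M (f L)) (sumℤ-swap L M f))
        (sym (sumℤ-distrib-+ M (λ t → sumℤ L (λ i → f i t)) (f L)))

sumℤ-exchange : ∀ L M (c : ℕ → ℤ) (a : ℕ → ℕ → ℤ) (g : ℕ → ℤ) →
  sumℤ L (λ i → c i ℤ.* sumℤ M (λ t → a i t ℤ.* g t)) ≡ sumℤ M (λ t → sumℤ L (λ i → c i ℤ.* a i t) ℤ.* g t)
sumℤ-exchange L M c a g = begin
  sumℤ L (λ i → c i ℤ.* sumℤ M (λ t → a i t ℤ.* g t))    ≡⟨ sumℤ-cong L (λ i _ → *-distribˡ-sumℤ M (c i) _) ⟩
  sumℤ L (λ i → sumℤ M (λ t → c i ℤ.* (a i t ℤ.* g t)))  ≡⟨ sumℤ-swap L M _ ⟩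
  sumℤ M (λ t → sumℤ L (λ i → c i ℤ.* (a i t ℤ.* g t)))  ≡⟨ sumℤ-cong M (λ t _ → factor t) ⟩
  sumℤ M (λ t → sumℤ L (λ i → c i ℤ.* a i t) ℤ.* g t)    ∎
  where
  factor : ∀ t → sumℤ L (λ i → c i ℤ.* (a i t ℤ.* g t)) ≡ sumℤ L (λ i → c i ℤ.* a i t) ℤ.* g t
  factor t = trans (sumℤ-cong L (λ i _ → sym (ℤ.*-assoc (c i) (a i t) (g t))))
                   (sym (*-distribʳ-sumℤ L (g t) (λ i → c i ℤ.* a i t)))

sumℤ-tail : ∀ {a b} (f : ℕ → ℤ) → a ≤ b → (∀ i → a ≤ i → f i ≡ 0ℤ) → sumℤ b f ≡ sumℤ a f
sumℤ-tail {a} f a≤b f≡0 with ℕ.m≤n⇒∃[o]m+o≡n a≤b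
... | c , refl = begin
  sumℤ (a + c) f
    ≡⟨ sumℤ-+ a c f ⟩
  sumℤ a f ℤ.+ sumℤ c (λ i → f (a + i))
    ≡⟨ cong (λ s → sumℤ a f ℤ.+ s) (sumℤ-zero c (λ i _ → f≡0 (a + i) (ℕ.m≤m+n a i))) ⟩
  sumℤ a f ℤ.+ 0ℤ
    ≡⟨ ℤ.+-identityʳ _ ⟩
  sumℤ a f ∎

-1^n*-1^n≡1 : ∀ n → -1ℤ ℤ.^ n ℤ.* -1ℤ ℤ.^ n ≡ 1ℤ
-1^n*-1^n≡1 zero    = refl
-1^n*-1^n≡1 (suc n) = trans (negate-both (-1ℤ ℤ.^ n)) (-1^n*-1^n≡1 n)
  where
  negate-both : ∀ x → (-1ℤ ℤ.* x) ℤ.* (-1ℤ ℤ.* x) ≡ x ℤ.* x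
  negate-both = solve-∀

-1^[n+n]≡1 : ∀ n → -1ℤ ℤ.^ (n + n) ≡ 1ℤ
-1^[n+n]≡1 n = trans (ℤ.^-distribˡ-+-* -1ℤ n n) (-1^n*-1^n≡1 n)

cancel-unit : ∀ s σ x → s ℤ.* σ ≡ 1ℤ → s ℤ.* (σ ℤ.* x) ≡ x
cancel-unit s σ x sσ≡1 = trans (sym (ℤ.*-assoc s σ x)) (trans (cong (ℤ._* x) sσ≡1) (ℤ.*-identityˡ x))

pos-*-≡ : ∀ w x y z → w * x ≡ y * z → + w ℤ.* + x ≡ + y ℤ.* + z
pos-*-≡ w x y z eq = trans (sym (ℤ.pos-* w x)) (trans (cong +_ eq) (ℤ.pos-* y z))

∣+m-+n∣≡m∸n : ∀ {m n} → n ≤ m → ℤ.∣ + m ℤ.- + n ∣ ≡ m ∸ n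
∣+m-+n∣≡m∸n {m} {n} n≤m = cong ℤ.∣_∣ (trans (ℤ.m-n≡m⊖n m n) (ℤ.⊖-≥ n≤m))

+[m+n]-+m≡+n : ∀ m n → + (m + n) ℤ.- + m ≡ + n
+[m+n]-+m≡+n m n = trans (cong (ℤ._- + m) (ℤ.pos-+ m n)) (cancel (+ m) (+ n))
  where
  cancel : ∀ m n → m ℤ.+ n ℤ.- m ≡ n
  cancel = solve-∀

-+m++[m+n]≡+n : ∀ m n → ℤ.- + m ℤ.+ + (m + n) ≡ + n
-+m++[m+n]≡+n m n = trans (cong (λ x → ℤ.- + m ℤ.+ x) (ℤ.pos-+ m n)) (cancel (+ m) (+ n))
  where
  cancel : ∀ m n → ℤ.- m ℤ.+ (m ℤ.+ n) ≡ n
  cancel = solve-∀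

+m-+[m+n]≡-+n : ∀ m n → + m ℤ.- + (m + n) ≡ ℤ.- + n
+m-+[m+n]≡-+n m n = trans (cong (λ x → + m ℤ.- x) (ℤ.pos-+ m n)) (cancel (+ m) (+ n))
  where
  cancel : ∀ m n → m ℤ.- (m ℤ.+ n) ≡ ℤ.- n
  cancel = solve-∀

-+n-1≡-[1+n] : ∀ n → ℤ.- + n ℤ.- + 1 ≡ -[1+ n ]
-+n-1≡-[1+n] n = rearrange (+ n)
  where
  rearrange : ∀ n → ℤ.- n ℤ.- + 1 ≡ ℤ.- (+ 1 ℤ.+ n)
  rearrange = solve-∀

-- Binomial coefficients

C-pascal : ∀ n k → suc n C suc k ≡ n C k + n C suc k
C-pascal n k = sym (nCk+nC[k+1]≡[n+1]C[k+1] n k)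

C-factorial : ∀ m k → ((m + k) C m) * (m ! * k !) ≡ (m + k) !
C-factorial m k = begin
  ((m + k) C m) * (m ! * k !)                ≡⟨ cong (λ x → ((m + k) C m) * (m ! * x !)) (sym (ℕ.m+n∸m≡n m k)) ⟩
  ((m + k) C m) * d                          ≡⟨ cong (_* d) (nCk≡n!/k![n-k]! m≤m+k) ⟩
  ((m + k) ! / d) * d                        ≡⟨ m/n*n≡m (k![n∸k]!∣n! m≤m+k) ⟩
  (m + k) !                                  ∎
  where
  m≤m+k = ℕ.m≤m+n m k
  d = m ! * (m + k ∸ m) !
  instance _ = ℕ._!*_!≢0 m (m + k ∸ m)

C-sym : ∀ m k → (m + k) C m ≡ (m + k) C k
C-sym m k = trans (nCk≡nC[n∸k] (ℕ.m≤m+n m k)) (cong ((m + k) C_) (ℕ.m+n∸m≡n m k))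

trinomial-revision : ∀ a b n → ((a + n) C (a + b)) * ((a + b) C a) ≡ ((a + n) C a) * (n C b)
trinomial-revision a b n with ℕ.≤-total b n
... | inj₂ n≤b with ℕ.m≤n⇒∃[o]m+o≡n n≤b
...   | zero  , refl rewrite ℕ.+-identityʳ n | nCn≡1 (a + n) | nCn≡1 n = ℕ.*-comm 1 ((a + n) C a)
...   | suc c , refl rewrite k>n⇒nCk≡0 (ℕ.+-monoʳ-< a (ℕ.m<m+n n (s≤s (z≤n {c}))))
                           | k>n⇒nCk≡0 (ℕ.m<m+n n (s≤s (z≤n {c}))) = sym (ℕ.*-zeroʳ ((a + n) C a))
trinomial-revision a b n | inj₁ b≤n with ℕ.m≤n⇒∃[o]m+o≡n b≤n
... | c , refl = ℕ.*-cancelʳ-≡ _ _ (a ! * (b ! * c !)) {{nonZero}} (begin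
    ((a + (b + c)) C (a + b)) * ((a + b) C a) * (a ! * (b ! * c !))
      ≡⟨ regroupˡ ((a + (b + c)) C (a + b)) ((a + b) C a) (a !) (b !) (c !) ⟩
    ((a + (b + c)) C (a + b)) * (((a + b) C a) * (a ! * b !) * c !)
      ≡⟨ cong (λ x → ((a + (b + c)) C (a + b)) * (x * c !)) (C-factorial a b) ⟩
    ((a + (b + c)) C (a + b)) * ((a + b) ! * c !)
      ≡⟨ cong (λ x → (x C (a + b)) * ((a + b) ! * c !)) (sym (ℕ.+-assoc a b c)) ⟩
    ((a + b + c) C (a + b)) * ((a + b) ! * c !)
      ≡⟨ C-factorial (a + b) c ⟩
    (a + b + c) !
      ≡⟨ cong _! (ℕ.+-assoc a b c) ⟩
    (a + (b + c)) !
      ≡⟨ C-factorial a (b + c) ⟨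
    ((a + (b + c)) C a) * (a ! * (b + c) !)
      ≡⟨ cong (λ x → ((a + (b + c)) C a) * (a ! * x)) (C-factorial b c) ⟨
    ((a + (b + c)) C a) * (a ! * (((b + c) C b) * (b ! * c !)))
      ≡⟨ regroupʳ ((a + (b + c)) C a) ((b + c) C b) (a !) (b !) (c !) ⟩
    ((a + (b + c)) C a) * ((b + c) C b) * (a ! * (b ! * c !)) ∎)
  where
  nonZero = ℕ.m*n≢0 (a !) (b ! * c !) {{a ℕ.!≢0}} {{ℕ._!*_!≢0 b c}}
  regroupˡ : ∀ x y p q r → x * y * (p * (q * r)) ≡ x * (y * (p * q) * r)
  regroupˡ = ℕ-Solver.solve-∀
  regroupʳ : ∀ x y p q r → x * (p * (y * (q * r))) ≡ x * y * (p * (q * r))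
  regroupʳ = ℕ-Solver.solve-∀

C-complement-revision : ∀ a u r → ((a + (u + r)) C r) * ((a + u) C a) ≡ ((a + (u + r)) C a) * ((u + r) C u)
C-complement-revision a u r = begin
  ((a + (u + r)) C r) * ((a + u) C a)        ≡⟨ cong (λ n → (n C r) * ((a + u) C a)) (ℕ.+-assoc a u r) ⟨
  ((a + u + r) C r) * ((a + u) C a)          ≡⟨ cong (_* ((a + u) C a)) (C-sym (a + u) r) ⟨
  ((a + u + r) C (a + u)) * ((a + u) C a)    ≡⟨ cong (λ n → (n C (a + u)) * ((a + u) C a)) (ℕ.+-assoc a u r) ⟩
  ((a + (u + r)) C (a + u)) * ((a + u) C a)  ≡⟨ trinomial-revision a u (u + r) ⟩
  ((a + (u + r)) C a) * ((u + r) C u)        ∎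

C-swap-revision : ∀ a b c → ((a + (b + c)) C a) * ((b + c) C b) ≡ ((a + (b + c)) C b) * ((a + c) C a)
C-swap-revision a b c = begin
  ((a + (b + c)) C a) * ((b + c) C b)        ≡⟨ trinomial-revision a b (b + c) ⟨
  ((a + (b + c)) C (a + b)) * ((a + b) C a)  ≡⟨ cong₂ (λ n x → (n C x) * ((a + b) C a)) (swap-middle a b c) (ℕ.+-comm a b) ⟩
  ((b + (a + c)) C (b + a)) * ((a + b) C a)  ≡⟨ cong (((b + (a + c)) C (b + a)) *_) (trans (C-sym a b) (cong (_C b) (ℕ.+-comm a b))) ⟩
  ((b + (a + c)) C (b + a)) * ((b + a) C b)  ≡⟨ trinomial-revision b a (a + c) ⟩
  ((b + (a + c)) C b) * ((a + c) C a)        ≡⟨ cong (λ n → (n C b) * ((a + c) C a)) (swap-middle b a c) ⟩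
  ((a + (b + c)) C b) * ((a + c) C a)        ∎
  where
  swap-middle : ∀ a b c → a + (b + c) ≡ b + (a + c)
  swap-middle = ℕ-Solver.solve-∀

C-absorption : ∀ n k → suc k * (suc n C suc k) ≡ suc n * (n C k)
C-absorption n k = begin
  suc k * (suc n C suc k)                ≡⟨ ℕ.*-comm (suc k) _ ⟩
  (suc n C suc k) * suc k                ≡⟨ cong ((suc n C suc k) *_) (nC1≡n (suc k)) ⟨
  (suc n C suc k) * (suc k C 1)          ≡⟨ trinomial-revision 1 k n ⟩
  (suc n C 1) * (n C k)                  ≡⟨ cong (_* (n C k)) (nC1≡n (suc n)) ⟩
  suc n * (n C k)                        ∎

C-absorption-sum : ∀ n k → suc k * (n C suc k) + k * (n C k) ≡ n * (n C k)
C-absorption-sum zero    zero    = refl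
C-absorption-sum zero    (suc k) = cong₂ _+_ (ℕ.*-zeroʳ (suc (suc k))) (ℕ.*-zeroʳ (suc k))
C-absorption-sum (suc n) zero    = trans (ℕ.+-identityʳ _) (C-absorption n 0)
C-absorption-sum (suc n) (suc k) = begin
  suc (suc k) * (suc n C suc (suc k)) + suc k * (suc n C suc k)
    ≡⟨ cong₂ _+_ (C-absorption n (suc k)) (C-absorption n k) ⟩
  suc n * (n C suc k) + suc n * (n C k)
    ≡⟨ ℕ.*-distribˡ-+ (suc n) (n C suc k) (n C k) ⟨
  suc n * ((n C suc k) + (n C k))
    ≡⟨ cong (suc n *_) (trans (ℕ.+-comm (n C suc k) (n C k)) (sym (C-pascal n k))) ⟩
  suc n * (suc n C suc k)                ∎

alternating-C-prefix : ∀ p v → sumℤ (suc v) (λ u → -1ℤ ℤ.^ u ℤ.* + (suc p C u)) ≡ -1ℤ ℤ.^ v ℤ.* + (p C v)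
alternating-C-prefix p zero    = refl
alternating-C-prefix p (suc v) = begin
  sumℤ (suc v) (λ u → -1ℤ ℤ.^ u ℤ.* + (suc p C u)) ℤ.+ -1ℤ ℤ.^ suc v ℤ.* + (suc p C suc v)
    ≡⟨ cong₂ (λ x y → x ℤ.+ -1ℤ ℤ.^ suc v ℤ.* y) (alternating-C-prefix p v)
             (trans (cong +_ (C-pascal p v)) (ℤ.pos-+ (p C v) (p C suc v))) ⟩
  -1ℤ ℤ.^ v ℤ.* + (p C v) ℤ.+ -1ℤ ℤ.* -1ℤ ℤ.^ v ℤ.* (+ (p C v) ℤ.+ + (p C suc v))
    ≡⟨ telescope (-1ℤ ℤ.^ v) (+ (p C v)) (+ (p C suc v)) ⟩
  -1ℤ ℤ.^ suc v ℤ.* + (p C suc v)        ∎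
  where
  telescope : ∀ s x y → s ℤ.* x ℤ.+ -1ℤ ℤ.* s ℤ.* (x ℤ.+ y) ≡ -1ℤ ℤ.* s ℤ.* y
  telescope = solve-∀

alternating-C : ∀ p → sumℤ (suc (suc p)) (λ u → -1ℤ ℤ.^ u ℤ.* + (suc p C u)) ≡ 0ℤ
alternating-C p = begin
  sumℤ (suc (suc p)) (λ u → -1ℤ ℤ.^ u ℤ.* + (suc p C u))
    ≡⟨ alternating-C-prefix p (suc p) ⟩
  -1ℤ ℤ.^ suc p ℤ.* + (p C suc p)
    ≡⟨ cong (λ x → -1ℤ ℤ.^ suc p ℤ.* + x) (k>n⇒nCk≡0 (ℕ.n<1+n p)) ⟩
  -1ℤ ℤ.^ suc p ℤ.* 0ℤ
    ≡⟨ ℤ.*-zeroʳ (-1ℤ ℤ.^ suc p) ⟩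
  0ℤ ∎

alternating-C-C : ∀ d p →
  sumℤ (suc p) (λ j → -1ℤ ℤ.^ j ℤ.* + ((suc d + p) C (suc d + j)) ℤ.* + ((d + j) C d)) ≡ 1ℤ
alternating-C-C d zero rewrite ℕ.+-identityʳ d | nCn≡1 (suc d) | nCn≡1 d = refl
alternating-C-C d (suc p) = begin
  sumℤ (suc (suc p)) (λ j → -1ℤ ℤ.^ j ℤ.* + (suc n C suc (d + j)) ℤ.* + ((d + j) C d))
    ≡⟨ sumℤ-cong (suc (suc p)) (λ j _ → pascal j) ⟩
  sumℤ (suc (suc p)) (λ j → lower j ℤ.+ upper j)
    ≡⟨ sumℤ-distrib-+ (suc (suc p)) lower upper ⟩
  sumℤ (suc (suc p)) lower ℤ.+ sumℤ (suc (suc p)) upper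
    ≡⟨ cong₂ ℤ._+_ lower-sum upper-sum ⟩
  0ℤ ℤ.+ 1ℤ ∎
  where
  n = d + suc p
  lower upper : ℕ → ℤ
  lower j = -1ℤ ℤ.^ j ℤ.* + (n C (d + j)) ℤ.* + ((d + j) C d)
  upper j = -1ℤ ℤ.^ j ℤ.* + (n C suc (d + j)) ℤ.* + ((d + j) C d)
  pascal : ∀ j → -1ℤ ℤ.^ j ℤ.* + (suc n C suc (d + j)) ℤ.* + ((d + j) C d) ≡ lower j ℤ.+ upper j
  pascal j = trans (cong (λ x → -1ℤ ℤ.^ j ℤ.* x ℤ.* + ((d + j) C d))
                         (trans (cong +_ (C-pascal n (d + j))) (ℤ.pos-+ (n C (d + j)) (n C suc (d + j)))))
                   (distribute (-1ℤ ℤ.^ j) (+ (n C (d + j))) (+ (n C suc (d + j))) (+ ((d + j) C d)))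
    where
    distribute : ∀ s x y z → s ℤ.* (x ℤ.+ y) ℤ.* z ≡ s ℤ.* x ℤ.* z ℤ.+ s ℤ.* y ℤ.* z
    distribute = solve-∀
  lower-sum : sumℤ (suc (suc p)) lower ≡ 0ℤ
  lower-sum = begin
    sumℤ (suc (suc p)) lower
      ≡⟨ sumℤ-cong (suc (suc p)) (λ j _ → revise j) ⟩
    sumℤ (suc (suc p)) (λ j → + (n C d) ℤ.* (-1ℤ ℤ.^ j ℤ.* + (suc p C j)))
      ≡⟨ *-distribˡ-sumℤ (suc (suc p)) (+ (n C d)) _ ⟨
    + (n C d) ℤ.* sumℤ (suc (suc p)) (λ j → -1ℤ ℤ.^ j ℤ.* + (suc p C j))
      ≡⟨ cong (+ (n C d) ℤ.*_) (alternating-C p) ⟩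
    + (n C d) ℤ.* 0ℤ
      ≡⟨ ℤ.*-zeroʳ (+ (n C d)) ⟩
    0ℤ ∎
    where
    revise : ∀ j → lower j ≡ + (n C d) ℤ.* (-1ℤ ℤ.^ j ℤ.* + (suc p C j))
    revise j = begin
      -1ℤ ℤ.^ j ℤ.* + (n C (d + j)) ℤ.* + ((d + j) C d)
        ≡⟨ ℤ.*-assoc (-1ℤ ℤ.^ j) (+ (n C (d + j))) (+ ((d + j) C d)) ⟩
      -1ℤ ℤ.^ j ℤ.* (+ (n C (d + j)) ℤ.* + ((d + j) C d))
        ≡⟨ cong (-1ℤ ℤ.^ j ℤ.*_) (pos-*-≡ (n C (d + j)) ((d + j) C d) (n C d) (suc p C j) (trinomial-revision d j (suc p))) ⟩
      -1ℤ ℤ.^ j ℤ.* (+ (n C d) ℤ.* + (suc p C j))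
        ≡⟨ commute (-1ℤ ℤ.^ j) (+ (n C d)) (+ (suc p C j)) ⟩
      + (n C d) ℤ.* (-1ℤ ℤ.^ j ℤ.* + (suc p C j)) ∎
      where
      commute : ∀ s x y → s ℤ.* (x ℤ.* y) ≡ x ℤ.* (s ℤ.* y)
      commute = solve-∀
  upper-sum : sumℤ (suc (suc p)) upper ≡ 1ℤ
  upper-sum = begin
    sumℤ (suc p) upper ℤ.+ upper (suc p)
      ≡⟨ cong₂ ℤ._+_ (trans (sumℤ-cong (suc p) (λ j _ → cong (λ x → upper′ x j) (ℕ.+-suc d p))) (alternating-C-C d p))
                     top-vanishes ⟩
    1ℤ ℤ.+ 0ℤ ∎
    where
    upper′ : ℕ → ℕ → ℤ
    upper′ x j = -1ℤ ℤ.^ j ℤ.* + (x C suc (d + j)) ℤ.* + ((d + j) C d)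
    top-vanishes : upper (suc p) ≡ 0ℤ
    top-vanishes rewrite k>n⇒nCk≡0 (ℕ.n<1+n n) =
      trans (cong (ℤ._* + ((d + suc p) C d)) (ℤ.*-zeroʳ (-1ℤ ℤ.^ suc p))) (ℤ.*-zeroˡ (+ ((d + suc p) C d)))

C-orthogonality : ∀ m {ℓ} t p → t + p ≡ ℓ →
  sumℤ (suc ℓ) (λ i → -1ℤ ℤ.^ i ℤ.* + ((m + ℓ) C (ℓ ∸ i)) ℤ.* + ((m + i) C (m + t)))
  ≡ -1ℤ ℤ.^ t ℤ.* + ((m + ℓ) C (m + t)) ℤ.* sumℤ (suc p) (λ u → -1ℤ ℤ.^ u ℤ.* + (p C u))
C-orthogonality m t p refl = begin
  sumℤ (suc (t + p)) F                           ≡⟨ cong (λ L → sumℤ L F) (ℕ.+-suc t p) ⟨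
  sumℤ (t + suc p) F                             ≡⟨ sumℤ-+ t (suc p) F ⟩
  sumℤ t F ℤ.+ sumℤ (suc p) (λ u → F (t + u))    ≡⟨ cong₂ ℤ._+_ (sumℤ-zero t below-t) (sumℤ-cong (suc p) above-t) ⟩
  0ℤ ℤ.+ sumℤ (suc p) (λ u → K ℤ.* alt u)        ≡⟨ ℤ.+-identityˡ _ ⟩
  sumℤ (suc p) (λ u → K ℤ.* alt u)               ≡⟨ *-distribˡ-sumℤ (suc p) K alt ⟨
  K ℤ.* sumℤ (suc p) alt                         ∎
  where
  F : ℕ → ℤ
  F i = -1ℤ ℤ.^ i ℤ.* + ((m + (t + p)) C (t + p ∸ i)) ℤ.* + ((m + i) C (m + t))
  K = -1ℤ ℤ.^ t ℤ.* + ((m + (t + p)) C (m + t))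
  alt : ℕ → ℤ
  alt u = -1ℤ ℤ.^ u ℤ.* + (p C u)
  below-t : ∀ i → i < t → F i ≡ 0ℤ
  below-t i i<t rewrite k>n⇒nCk≡0 (ℕ.+-monoʳ-< m i<t) = ℤ.*-zeroʳ (-1ℤ ℤ.^ i ℤ.* + ((m + (t + p)) C (t + p ∸ i)))
  above-t : ∀ u → u < suc p → F (t + u) ≡ K ℤ.* alt u
  above-t u (s≤s u≤p) with ℕ.m≤n⇒∃[o]m+o≡n u≤p
  ... | r , refl rewrite sym (ℕ.+-assoc m t u) | sym (ℕ.+-assoc m t (u + r)) | ℤ.^-distribˡ-+-* -1ℤ t u = begin
    s ℤ.* σ ℤ.* + ((a + (u + r)) C (t + (u + r) ∸ (t + u))) ℤ.* + ((a + u) C a)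
      ≡⟨ cong (λ x → s ℤ.* σ ℤ.* + ((a + (u + r)) C x) ℤ.* + ((a + u) C a)) complement ⟩
    s ℤ.* σ ℤ.* + ((a + (u + r)) C r) ℤ.* + ((a + u) C a)
      ≡⟨ regroup s σ (+ ((a + (u + r)) C r)) (+ ((a + u) C a)) ⟩
    s ℤ.* σ ℤ.* (+ ((a + (u + r)) C r) ℤ.* + ((a + u) C a))
      ≡⟨ cong (s ℤ.* σ ℤ.*_) (pos-*-≡ ((a + (u + r)) C r) ((a + u) C a) ((a + (u + r)) C a) ((u + r) C u)
                                      (C-complement-revision a u r)) ⟩
    s ℤ.* σ ℤ.* (+ ((a + (u + r)) C a) ℤ.* + ((u + r) C u))
      ≡⟨ regroup′ s σ (+ ((a + (u + r)) C a)) (+ ((u + r) C u)) ⟩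
    s ℤ.* + ((a + (u + r)) C a) ℤ.* (σ ℤ.* + ((u + r) C u)) ∎
    where
    a = m + t
    s = -1ℤ ℤ.^ t
    σ = -1ℤ ℤ.^ u
    complement : t + (u + r) ∸ (t + u) ≡ r
    complement = trans (ℕ.[m+n]∸[m+o]≡n∸o t (u + r) u) (ℕ.m+n∸m≡n u r)
    regroup : ∀ s σ x y → s ℤ.* σ ℤ.* x ℤ.* y ≡ s ℤ.* σ ℤ.* (x ℤ.* y)
    regroup = solve-∀
    regroup′ : ∀ s σ x y → s ℤ.* σ ℤ.* (x ℤ.* y) ≡ s ℤ.* x ℤ.* (σ ℤ.* y)
    regroup′ = solve-∀

binomial-inversion : ∀ m ℓ (f g : ℕ → ℤ) →
  (∀ i → i ≤ ℓ → f i ≡ sumℤ (suc ℓ) (λ t → + ((m + i) C (m + t)) ℤ.* g t)) →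
  -1ℤ ℤ.^ ℓ ℤ.* sumℤ (suc ℓ) (λ i → -1ℤ ℤ.^ i ℤ.* + ((m + ℓ) C (ℓ ∸ i)) ℤ.* f i) ≡ g ℓ
binomial-inversion m ℓ f g f≡ = begin
  s ℤ.* sumℤ (suc ℓ) (λ i → c i ℤ.* f i)
    ≡⟨ cong (s ℤ.*_) (sumℤ-cong (suc ℓ) (λ i i≤ℓ → cong (c i ℤ.*_) (f≡ i (ℕ.≤-pred i≤ℓ)))) ⟩
  s ℤ.* sumℤ (suc ℓ) (λ i → c i ℤ.* sumℤ (suc ℓ) (λ t → + ((m + i) C (m + t)) ℤ.* g t))
    ≡⟨ cong (s ℤ.*_) (sumℤ-exchange (suc ℓ) (suc ℓ) c (λ i t → + ((m + i) C (m + t))) g) ⟩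
  s ℤ.* (sumℤ ℓ (λ t → X t ℤ.* g t) ℤ.+ X ℓ ℤ.* g ℓ)
    ≡⟨ cong₂ (λ x y → s ℤ.* (x ℤ.+ y ℤ.* g ℓ))
             (sumℤ-zero ℓ (λ t t<ℓ → trans (cong (ℤ._* g t) (X-below t t<ℓ)) (ℤ.*-zeroˡ (g t)))) X-diag ⟩
  s ℤ.* (0ℤ ℤ.+ s ℤ.* g ℓ)
    ≡⟨ cong (s ℤ.*_) (ℤ.+-identityˡ (s ℤ.* g ℓ)) ⟩
  s ℤ.* (s ℤ.* g ℓ)
    ≡⟨ cancel-unit s s (g ℓ) (-1^n*-1^n≡1 ℓ) ⟩
  g ℓ ∎
  where
  s = -1ℤ ℤ.^ ℓ
  c X : ℕ → ℤ
  c i = -1ℤ ℤ.^ i ℤ.* + ((m + ℓ) C (ℓ ∸ i))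
  X t = sumℤ (suc ℓ) (λ i → c i ℤ.* + ((m + i) C (m + t)))
  X-below : ∀ t → t < ℓ → X t ≡ 0ℤ
  X-below t t<ℓ with ℕ.m≤n⇒∃[o]m+o≡n t<ℓ
  ... | q , eq = begin
    X t                                   ≡⟨ C-orthogonality m t (suc q) (trans (ℕ.+-suc t q) eq) ⟩
    K ℤ.* sumℤ (suc (suc q)) _            ≡⟨ cong (K ℤ.*_) (alternating-C q) ⟩
    K ℤ.* 0ℤ                              ≡⟨ ℤ.*-zeroʳ K ⟩
    0ℤ                                    ∎
    where
    K = -1ℤ ℤ.^ t ℤ.* + ((m + ℓ) C (m + t))
  X-diag : X ℓ ≡ s
  X-diag = begin
    X ℓ                                         ≡⟨ C-orthogonality m ℓ 0 (ℕ.+-identityʳ ℓ) ⟩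
    s ℤ.* + ((m + ℓ) C (m + ℓ)) ℤ.* 1ℤ          ≡⟨ cong (λ x → s ℤ.* + x ℤ.* 1ℤ) (nCn≡1 (m + ℓ)) ⟩
    s ℤ.* 1ℤ ℤ.* 1ℤ                             ≡⟨ trans (ℤ.*-identityʳ _) (ℤ.*-identityʳ s) ⟩
    s                                           ∎

extrapolation-coefficient : ∀ d p l₀ {M} → suc p + l₀ ≡ M →
  sumℤ M (λ j → -1ℤ ℤ.^ j ℤ.* + ((M + (M + suc d)) C (suc d + j)) ℤ.* + ((d + j) C d)
                  ℤ.* + ((M + (M ∸ j)) C (M + suc l₀)))
  ≡ + ((M + (M + suc d)) C (M + suc l₀))
extrapolation-coefficient d p l₀ {M} refl = begin
  sumℤ (suc p + l₀) F
    ≡⟨ sumℤ-+ (suc p) l₀ F ⟩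
  sumℤ (suc p) F ℤ.+ sumℤ l₀ (λ u → F (suc p + u))
    ≡⟨ cong₂ ℤ._+_ (sumℤ-cong (suc p) (λ j j≤p → revise j (ℕ.≤-pred j≤p))) (sumℤ-zero l₀ (λ u _ → beyond-p u)) ⟩
  sumℤ (suc p) (λ j → K ℤ.* A j) ℤ.+ 0ℤ
    ≡⟨ ℤ.+-identityʳ _ ⟩
  sumℤ (suc p) (λ j → K ℤ.* A j)
    ≡⟨ *-distribˡ-sumℤ (suc p) K A ⟨
  K ℤ.* sumℤ (suc p) A
    ≡⟨ cong (K ℤ.*_) (alternating-C-C d p) ⟩
  K ℤ.* 1ℤ
    ≡⟨ ℤ.*-identityʳ K ⟩
  K ∎
  where
  N = M + (M + suc d)
  b = M + suc l₀
  K = + (N C b)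
  F A : ℕ → ℤ
  F j = -1ℤ ℤ.^ j ℤ.* + (N C (suc d + j)) ℤ.* + ((d + j) C d) ℤ.* + ((M + (M ∸ j)) C b)
  A j = -1ℤ ℤ.^ j ℤ.* + ((suc d + p) C (suc d + j)) ℤ.* + ((d + j) C d)
  beyond-p : ∀ u → F (suc p + u) ≡ 0ℤ
  beyond-p u = trans (cong (λ x → prefix ℤ.* + x) (k>n⇒nCk≡0 (ℕ.+-monoʳ-< M (s≤s remaining≤l₀)))) (ℤ.*-zeroʳ prefix)
    where
    prefix = -1ℤ ℤ.^ (suc p + u) ℤ.* + (N C (suc d + (suc p + u))) ℤ.* + ((d + (suc p + u)) C d)
    remaining≤l₀ : M ∸ (suc p + u) ≤ l₀
    remaining≤l₀ = subst (_≤ l₀) (sym (ℕ.[m+n]∸[m+o]≡n∸o (suc p) l₀ u)) (ℕ.m∸n≤m l₀ u)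
  revise : ∀ j → j ≤ p → F j ≡ K ℤ.* A j
  revise j j≤p with ℕ.m≤n⇒∃[o]m+o≡n j≤p
  ... | r , refl = begin
    s ℤ.* + (N C a) ℤ.* x ℤ.* + ((M + (M ∸ j)) C b)
      ≡⟨ regroup s (+ (N C a)) x (+ ((M + (M ∸ j)) C b)) ⟩
    s ℤ.* x ℤ.* (+ (N C a) ℤ.* + ((M + (M ∸ j)) C b))
      ≡⟨ cong (s ℤ.* x ℤ.*_) (pos-*-≡ (N C a) ((M + (M ∸ j)) C b) (N C b) ((suc d + p) C a) swap) ⟩
    s ℤ.* x ℤ.* (K ℤ.* + ((suc d + p) C a))
      ≡⟨ regroup′ s x K (+ ((suc d + p) C a)) ⟩
    K ℤ.* (s ℤ.* + ((suc d + p) C a) ℤ.* x) ∎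
    where
    a = suc d + j
    s = -1ℤ ℤ.^ j
    x = + ((d + j) C d)
    total : N ≡ a + (b + r)
    total = rearrange d j r l₀
      where
      rearrange : ∀ d j r l₀ → suc (j + r) + l₀ + (suc (j + r) + l₀ + suc d) ≡ suc d + j + (suc (j + r) + l₀ + suc l₀ + r)
      rearrange = ℕ-Solver.solve-∀
    remaining : M + (M ∸ j) ≡ b + r
    remaining = begin
      M + (M ∸ j)                  ≡⟨ cong (λ m → M + (m ∸ j)) (split j r l₀) ⟩
      M + (j + (suc r + l₀) ∸ j)   ≡⟨ cong (_+_ M) (ℕ.m+n∸m≡n j (suc r + l₀)) ⟩
      M + (suc r + l₀)             ≡⟨ shuffle M r l₀ ⟩
      b + r                        ∎
      where
      split : ∀ j r l₀ → suc (j + r) + l₀ ≡ j + (suc r + l₀)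
      split = ℕ-Solver.solve-∀
      shuffle : ∀ M r l₀ → M + (suc r + l₀) ≡ M + suc l₀ + r
      shuffle = ℕ-Solver.solve-∀
    swap : (N C a) * ((M + (M ∸ j)) C b) ≡ (N C b) * ((suc d + p) C a)
    swap = begin
      (N C a) * ((M + (M ∸ j)) C b)         ≡⟨ cong₂ (λ n n′ → (n C a) * (n′ C b)) total remaining ⟩
      ((a + (b + r)) C a) * ((b + r) C b)   ≡⟨ C-swap-revision a b r ⟩
      ((a + (b + r)) C b) * ((a + r) C a)   ≡⟨ cong₂ (λ n n′ → (n C b) * (n′ C a)) (sym total) (ℕ.+-assoc (suc d) j r) ⟩
      (N C b) * ((suc d + p) C a)           ∎
    regroup : ∀ s y x z → s ℤ.* y ℤ.* x ℤ.* z ≡ s ℤ.* x ℤ.* (y ℤ.* z)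
    regroup = solve-∀
    regroup′ : ∀ s x K y → s ℤ.* x ℤ.* (K ℤ.* y) ≡ K ℤ.* (s ℤ.* y ℤ.* x)
    regroup′ = solve-∀

-- If f r = Σ_l C(M + r, M + l) g l for r ≤ M, the values f 1, …, f M already determine what this
-- formula gives at r = M + d + 1.
binomial-extrapolation : ∀ M d (f g : ℕ → ℤ) → g 0 ≡ 0ℤ →
  (∀ r → r ≤ M → f r ≡ sumℤ (suc M) (λ l → + ((M + r) C (M + l)) ℤ.* g l)) →
  sumℤ M (λ j → -1ℤ ℤ.^ j ℤ.* + ((M + (M + suc d)) C (suc d + j)) ℤ.* + ((d + j) C d) ℤ.* f (M ∸ j))
  ≡ sumℤ (suc M) (λ l → + ((M + (M + suc d)) C (M + l)) ℤ.* g l)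
binomial-extrapolation M d f g g0≡0 f≡ = begin
  sumℤ M (λ j → c j ℤ.* f (M ∸ j))
    ≡⟨ sumℤ-cong M (λ j _ → cong (c j ℤ.*_) (f≡ (M ∸ j) (ℕ.m∸n≤m M j))) ⟩
  sumℤ M (λ j → c j ℤ.* sumℤ (suc M) (λ l → + ((M + (M ∸ j)) C (M + l)) ℤ.* g l))
    ≡⟨ sumℤ-exchange M (suc M) c (λ j l → + ((M + (M ∸ j)) C (M + l))) g ⟩
  sumℤ (suc M) (λ l → sumℤ M (λ j → c j ℤ.* + ((M + (M ∸ j)) C (M + l))) ℤ.* g l)
    ≡⟨ sumℤ-cong (suc M) coefficient ⟩
  sumℤ (suc M) (λ l → + ((M + (M + suc d)) C (M + l)) ℤ.* g l) ∎
  where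
  c : ℕ → ℤ
  c j = -1ℤ ℤ.^ j ℤ.* + ((M + (M + suc d)) C (suc d + j)) ℤ.* + ((d + j) C d)
  coefficient : ∀ l → l < suc M →
    sumℤ M (λ j → c j ℤ.* + ((M + (M ∸ j)) C (M + l))) ℤ.* g l ≡ + ((M + (M + suc d)) C (M + l)) ℤ.* g l
  coefficient zero     _         rewrite g0≡0 =
    trans (ℤ.*-zeroʳ (sumℤ M (λ j → c j ℤ.* + ((M + (M ∸ j)) C (M + 0))))) (sym (ℤ.*-zeroʳ (+ ((M + (M + suc d)) C (M + 0)))))
  coefficient (suc l₀) (s≤s l<M) with ℕ.m≤n⇒∃[o]m+o≡n l<M
  ... | p , eq = cong (ℤ._* g (suc l₀)) (extrapolation-coefficient d p l₀ (trans (cong suc (ℕ.+-comm p l₀)) eq))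

-- Stirling numbers

S-vanish : ∀ {n k} → n < k → S n k ≡ 0
S-vanish {zero}  {suc k} n<k       = refl
S-vanish {suc n} {suc k} (s≤s n<k) rewrite S-vanish (ℕ.m<n⇒m<1+n n<k) | S-vanish n<k = trans (ℕ.+-identityʳ _) (ℕ.*-zeroʳ (suc k))

S-diag : ∀ n → S n n ≡ 1
S-diag zero    = refl
S-diag (suc n) rewrite S-vanish (ℕ.n<1+n n) | S-diag n = cong (_+ 1) (ℕ.*-zeroʳ n)

S₂ : ℕ → ℕ → ℕ
S₂ zero    zero    = 1
S₂ zero    (suc l) = 0
S₂ (suc m) zero    = 0
S₂ (suc m) (suc l) = suc l * S₂ m (suc l) + (m + suc l) * S₂ m l

S₂-vanish : ∀ {m l} → m < l → S₂ m l ≡ 0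
S₂-vanish {zero}  {suc l} m<l       = refl
S₂-vanish {suc m} {suc l} (s≤s m<l) rewrite S₂-vanish (ℕ.m<n⇒m<1+n m<l) | S₂-vanish m<l
  = cong₂ _+_ (ℕ.*-zeroʳ (suc l)) (ℕ.*-zeroʳ (m + suc l))

C-absorption-shifted : ∀ m k l →
  + l ℤ.* + (suc (m + k) C (m + l)) ℤ.+ + (m + suc l) ℤ.* + (suc (m + k) C (m + suc l))
  ≡ + suc k ℤ.* + (suc (m + k) C (m + l))
C-absorption-shifted m k l rewrite ℕ.+-suc m l =
  trans (sym (trans (ℤ.pos-+ (l * x) (suc (m + l) * y)) (cong₂ ℤ._+_ (ℤ.pos-* l x) (ℤ.pos-* (suc (m + l)) y))))
        (trans (cong +_ in-ℕ) (ℤ.pos-* (suc k) x))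
  where
  x = suc (m + k) C (m + l)
  y = suc (m + k) C suc (m + l)
  in-ℕ : l * x + suc (m + l) * y ≡ suc k * x
  in-ℕ = ℕ.+-cancelʳ-≡ (m * x) _ _ (begin
    l * x + suc (m + l) * y + m * x     ≡⟨ regroup l m x y ⟩
    suc (m + l) * y + (m + l) * x       ≡⟨ C-absorption-sum (suc (m + k)) (m + l) ⟩
    suc (m + k) * x                     ≡⟨ regroup′ m k x ⟩
    suc k * x + m * x                   ∎)
    where
    regroup : ∀ l m x y → l * x + suc (m + l) * y + m * x ≡ suc (m + l) * y + (m + l) * x
    regroup = ℕ-Solver.solve-∀
    regroup′ : ∀ m k x → suc (m + k) * x ≡ suc k * x + m * x
    regroup′ = ℕ-Solver.solve-∀

S₂-absorbed-sum : ∀ m k L → k < L →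
  + suc k ℤ.* sumℤ (suc L) (λ l → + (suc (m + k) C (m + l)) ℤ.* + S₂ m l)
  ≡ sumℤ (suc L) (λ l → + (suc (m + k) C (m + l)) ℤ.* + S₂ (suc m) l)
S₂-absorbed-sum m k L k<L = sym (begin
  sumℤ (suc L) (λ l → c l ℤ.* s′ l)
    ≡⟨ sumℤ-suc L (λ l → c l ℤ.* s′ l) ⟩
  c 0 ℤ.* 0ℤ ℤ.+ sumℤ L (λ l → c (suc l) ℤ.* s′ (suc l))
    ≡⟨ cong (ℤ._+ sumℤ L (λ l → c (suc l) ℤ.* s′ (suc l))) (ℤ.*-zeroʳ (c 0)) ⟩
  0ℤ ℤ.+ sumℤ L (λ l → c (suc l) ℤ.* s′ (suc l))
    ≡⟨ ℤ.+-identityˡ _ ⟩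
  sumℤ L (λ l → c (suc l) ℤ.* s′ (suc l))
    ≡⟨ sumℤ-cong L (λ l _ → unfold-S₂ l) ⟩
  sumℤ L (λ l → up (suc l) ℤ.+ down l)
    ≡⟨ sumℤ-distrib-+ L (up ∘ suc) down ⟩
  sumℤ L (up ∘ suc) ℤ.+ sumℤ L down
    ≡⟨ cong₂ ℤ._+_ (sym (trans (sumℤ-suc L up) (ℤ.+-identityˡ (sumℤ L (up ∘ suc)))))
                   (sym (trans (cong (λ x → sumℤ L down ℤ.+ x) down-L≡0) (ℤ.+-identityʳ (sumℤ L down)))) ⟩
  sumℤ (suc L) up ℤ.+ sumℤ (suc L) down
    ≡⟨ sumℤ-distrib-+ (suc L) up down ⟨
  sumℤ (suc L) (λ l → up l ℤ.+ down l)
    ≡⟨ sumℤ-cong (suc L) (λ l _ → absorb l) ⟩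
  sumℤ (suc L) (λ l → + suc k ℤ.* (c l ℤ.* s l))
    ≡⟨ *-distribˡ-sumℤ (suc L) (+ suc k) (λ l → c l ℤ.* s l) ⟨
  + suc k ℤ.* sumℤ (suc L) (λ l → c l ℤ.* s l) ∎)
  where
  c s s′ up down : ℕ → ℤ
  c l = + (suc (m + k) C (m + l))
  s l = + S₂ m l
  s′ l = + S₂ (suc m) l
  up l = + l ℤ.* c l ℤ.* s l
  down l = + (m + suc l) ℤ.* c (suc l) ℤ.* s l
  unfold-S₂ : ∀ l → c (suc l) ℤ.* s′ (suc l) ≡ up (suc l) ℤ.+ down l
  unfold-S₂ l = begin
    c (suc l) ℤ.* + (suc l * S₂ m (suc l) + (m + suc l) * S₂ m l)
      ≡⟨ cong (c (suc l) ℤ.*_) (trans (ℤ.pos-+ (suc l * S₂ m (suc l)) _)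
                                       (cong₂ ℤ._+_ (ℤ.pos-* (suc l) _) (ℤ.pos-* (m + suc l) _))) ⟩
    c (suc l) ℤ.* (+ suc l ℤ.* s (suc l) ℤ.+ + (m + suc l) ℤ.* s l)
      ≡⟨ distribute (c (suc l)) (+ suc l) (s (suc l)) (+ (m + suc l)) (s l) ⟩
    up (suc l) ℤ.+ down l ∎
    where
    distribute : ∀ c a x b y → c ℤ.* (a ℤ.* x ℤ.+ b ℤ.* y) ≡ a ℤ.* c ℤ.* x ℤ.+ b ℤ.* c ℤ.* y
    distribute = solve-∀
  down-L≡0 : down L ≡ 0ℤ
  down-L≡0 rewrite k>n⇒nCk≡0 {suc (m + k)} {m + suc L} (subst (suc (m + k) <_) (sym (ℕ.+-suc m L)) (s≤s (ℕ.+-monoʳ-< m k<L)))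
    = trans (cong (ℤ._* s L) (ℤ.*-zeroʳ (+ (m + suc L)))) (ℤ.*-zeroˡ (s L))
  absorb : ∀ l → up l ℤ.+ down l ≡ + suc k ℤ.* (c l ℤ.* s l)
  absorb l = begin
    up l ℤ.+ down l                                                ≡⟨ factor (+ l) (c l) (+ (m + suc l)) (c (suc l)) (s l) ⟩
    (+ l ℤ.* c l ℤ.+ + (m + suc l) ℤ.* c (suc l)) ℤ.* s l          ≡⟨ cong (ℤ._* s l) (C-absorption-shifted m k l) ⟩
    + suc k ℤ.* c l ℤ.* s l                                        ≡⟨ ℤ.*-assoc (+ suc k) (c l) (s l) ⟩
    + suc k ℤ.* (c l ℤ.* s l)                                      ∎
    where
    factor : ∀ a x b y z → a ℤ.* x ℤ.* z ℤ.+ b ℤ.* y ℤ.* z ≡ (a ℤ.* x ℤ.+ b ℤ.* y) ℤ.* z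
    factor = solve-∀

S-expansion-step : ∀ m k L → k < L →
  + S (m + suc k) (suc k) ≡ sumℤ (suc L) (λ l → + ((m + suc k) C (m + l)) ℤ.* + S₂ m l) →
  + S (suc (m + k)) k ≡ sumℤ (suc L) (λ l → + (suc (m + k) C suc (m + l)) ℤ.* + S₂ (suc m) l) →
  + S (suc (m + suc k)) (suc k) ≡ sumℤ (suc L) (λ l → + (suc (m + suc k) C suc (m + l)) ℤ.* + S₂ (suc m) l)
S-expansion-step m k L k<L ih₁ ih₂ rewrite ℕ.+-suc m k = begin
  + (suc k * S N (suc k) + S N k)
    ≡⟨ trans (ℤ.pos-+ (suc k * S N (suc k)) (S N k)) (cong (ℤ._+ + S N k) (ℤ.pos-* (suc k) (S N (suc k)))) ⟩
  + suc k ℤ.* + S N (suc k) ℤ.+ + S N k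
    ≡⟨ cong₂ (λ x y → + suc k ℤ.* x ℤ.+ y) ih₁ ih₂ ⟩
  + suc k ℤ.* sumℤ (suc L) (λ l → c l ℤ.* + S₂ m l) ℤ.+ sumℤ (suc L) (λ l → c′ l ℤ.* s′ l)
    ≡⟨ cong (ℤ._+ sumℤ (suc L) (λ l → c′ l ℤ.* s′ l)) (S₂-absorbed-sum m k L k<L) ⟩
  sumℤ (suc L) (λ l → c l ℤ.* s′ l) ℤ.+ sumℤ (suc L) (λ l → c′ l ℤ.* s′ l)
    ≡⟨ sumℤ-distrib-+ (suc L) (λ l → c l ℤ.* s′ l) (λ l → c′ l ℤ.* s′ l) ⟨
  sumℤ (suc L) (λ l → c l ℤ.* s′ l ℤ.+ c′ l ℤ.* s′ l)
    ≡⟨ sumℤ-cong (suc L) (λ l _ → pascal l) ⟩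
  sumℤ (suc L) (λ l → + (suc N C suc (m + l)) ℤ.* s′ l) ∎
  where
  N = suc (m + k)
  c c′ s′ : ℕ → ℤ
  c l = + (N C (m + l))
  c′ l = + (N C suc (m + l))
  s′ l = + S₂ (suc m) l
  pascal : ∀ l → c l ℤ.* s′ l ℤ.+ c′ l ℤ.* s′ l ≡ + (suc N C suc (m + l)) ℤ.* s′ l
  pascal l = begin
    c l ℤ.* s′ l ℤ.+ c′ l ℤ.* s′ l
      ≡⟨ ℤ.*-distribʳ-+ (s′ l) (c l) (c′ l) ⟨
    (c l ℤ.+ c′ l) ℤ.* s′ l
      ≡⟨ cong (ℤ._* s′ l) (trans (cong +_ (C-pascal N (m + l))) (ℤ.pos-+ (N C (m + l)) (N C suc (m + l)))) ⟨
    + (suc N C suc (m + l)) ℤ.* s′ l ∎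

-- Choose the m + l elements that lie in blocks of size at least 2.
S-expansion : ∀ m k L → k < L → + S (m + k) k ≡ sumℤ L (λ l → + ((m + k) C (m + l)) ℤ.* + S₂ m l)
S-expansion zero    k       (suc L) _ = begin
  + S k k
    ≡⟨ cong +_ (S-diag k) ⟩
  1ℤ ℤ.+ 0ℤ
    ≡⟨ cong (λ x → 1ℤ ℤ.+ x) (sumℤ-zero L (λ l _ → ℤ.*-zeroʳ (+ (k C suc l)))) ⟨
  1ℤ ℤ.+ sumℤ L (λ l → + (k C suc l) ℤ.* + S₂ 0 (suc l))
    ≡⟨ sumℤ-suc L (λ l → + (k C l) ℤ.* + S₂ 0 l) ⟨
  sumℤ (suc L) (λ l → + (k C l) ℤ.* + S₂ 0 l) ∎
S-expansion (suc m) zero    L       _ = sym (sumℤ-zero L vanish)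
  where
  vanish : ∀ l → l < L → + (suc (m + 0) C suc (m + l)) ℤ.* + S₂ (suc m) l ≡ 0ℤ
  vanish zero    _ = ℤ.*-zeroʳ (+ (suc (m + 0) C suc (m + 0)))
  vanish (suc l) _ rewrite k>n⇒nCk≡0 (s≤s (ℕ.+-monoʳ-< m (s≤s (z≤n {l})))) = refl
S-expansion (suc m) (suc k) (suc L) (s≤s k<L) =
  S-expansion-step m k L k<L (S-expansion m (suc k) (suc L) (s≤s k<L)) (S-expansion (suc m) k (suc L) (ℕ.m<n⇒m<1+n k<L))

S₂-via-S : ∀ m ℓ →
  -1ℤ ℤ.^ ℓ ℤ.* sumℤ (suc ℓ) (λ i → -1ℤ ℤ.^ i ℤ.* + ((m + ℓ) C (ℓ ∸ i)) ℤ.* + S (m + i) i) ≡ + S₂ m ℓ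
S₂-via-S m ℓ =
  binomial-inversion m ℓ (λ i → + S (m + i) i) (λ l → + S₂ m l) (λ i i≤ℓ → S-expansion m i (suc ℓ) (s≤s i≤ℓ))

S-via-S₂ : ∀ m k → 0 < m → + S (m + k) k ≡ sumℤ m (λ j → + ((m + k) C (m + suc j)) ℤ.* + S₂ m (suc j))
S-via-S₂ m@(suc _) k _ = begin
  + S (m + k) k
    ≡⟨ S-expansion m k (suc (m + k)) (s≤s (ℕ.m≤n+m k m)) ⟩
  sumℤ (suc (m + k)) term
    ≡⟨ sumℤ-suc (m + k) term ⟩
  term 0 ℤ.+ sumℤ (m + k) (term ∘ suc)
    ≡⟨ cong₂ ℤ._+_ (ℤ.*-zeroʳ (+ ((m + k) C (m + 0)))) (sumℤ-tail (term ∘ suc) (ℕ.m≤m+n m k) beyond-m) ⟩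
  0ℤ ℤ.+ sumℤ m (term ∘ suc)
    ≡⟨ ℤ.+-identityˡ _ ⟩
  sumℤ m (term ∘ suc) ∎
  where
  term : ℕ → ℤ
  term l = + ((m + k) C (m + l)) ℤ.* + S₂ m l
  beyond-m : ∀ j → m ≤ j → term (suc j) ≡ 0ℤ
  beyond-m j m≤j rewrite S₂-vanish (s≤s m≤j) = ℤ.*-zeroʳ (+ ((m + k) C (m + suc j)))

-- The first identity

toℚᵘ-/1 : ∀ a → ℚ.toℚᵘ (a ℚ./ 1) ℚᵘ.≃ mkℚᵘ a 0
toℚᵘ-/1 a = ℚ.toℚᵘ-fromℚᵘ (mkℚᵘ a 0)

/1-homo-+ : ∀ a b → (a ℤ.+ b) ℚ./ 1 ≡ a ℚ./ 1 ℚ.+ b ℚ./ 1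
/1-homo-+ a b = ℚ.toℚᵘ-injective (ℚᵘ.≃-trans (toℚᵘ-/1 (a ℤ.+ b)) (ℚᵘ.≃-trans (*≡* (same-numerator a b))
  (ℚᵘ.≃-sym (ℚᵘ.≃-trans (ℚ.toℚᵘ-homo-+ (a ℚ./ 1) (b ℚ./ 1)) (ℚᵘ.+-cong (toℚᵘ-/1 a) (toℚᵘ-/1 b))))))
  where
  same-numerator : ∀ a b → (a ℤ.+ b) ℤ.* (+ 1 ℤ.* + 1) ≡ (a ℤ.* + 1 ℤ.+ b ℤ.* + 1) ℤ.* + 1
  same-numerator = solve-∀

/1-homo-* : ∀ a b → (a ℤ.* b) ℚ./ 1 ≡ (a ℚ./ 1) ℚ.* (b ℚ./ 1)
/1-homo-* a b = ℚ.toℚᵘ-injective (ℚᵘ.≃-trans (toℚᵘ-/1 (a ℤ.* b)) (ℚᵘ.≃-trans (*≡* (same-numerator a b))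
  (ℚᵘ.≃-sym (ℚᵘ.≃-trans (ℚ.toℚᵘ-homo-* (a ℚ./ 1) (b ℚ./ 1)) (ℚᵘ.*-cong (toℚᵘ-/1 a) (toℚᵘ-/1 b))))))
  where
  same-numerator : ∀ a b → (a ℤ.* b) ℤ.* (+ 1 ℤ.* + 1) ≡ (a ℤ.* b) ℤ.* + 1
  same-numerator = solve-∀

/1-*-/-cancel : ∀ c a e D .{{_ : ℕ.NonZero D}} → c * a ≡ e * D → (+ c ℚ./ 1) ℚ.* (+ a ℚ./ D) ≡ + e ℚ./ 1
/1-*-/-cancel c a e (suc d) ca≡eD = ℚ.toℚᵘ-injective (ℚᵘ.≃-trans (ℚ.toℚᵘ-homo-* (+ c ℚ./ 1) (+ a ℚ./ suc d))
  (ℚᵘ.≃-trans (ℚᵘ.*-cong (toℚᵘ-/1 (+ c)) (ℚ.toℚᵘ-fromℚᵘ (mkℚᵘ (+ a) d)))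
  (ℚᵘ.≃-trans (*≡* cross) (ℚᵘ.≃-sym (toℚᵘ-/1 (+ e))))))
  where
  cross : (+ c ℤ.* + a) ℤ.* + 1 ≡ + e ℤ.* (+ 1 ℤ.* + suc d)
  cross = begin
    (+ c ℤ.* + a) ℤ.* + 1     ≡⟨ ℤ.*-identityʳ _ ⟩
    + c ℤ.* + a               ≡⟨ pos-*-≡ c a e (suc d) ca≡eD ⟩
    + e ℤ.* + suc d           ≡⟨ cong (+ e ℤ.*_) (ℤ.*-identityˡ (+ suc d)) ⟨
    + e ℤ.* (+ 1 ℤ.* + suc d) ∎

C-ratio : ∀ m k ℓ → (+ ((m + k) C k) ℚ./ 1) ℚ.* ratio k ℓ m ≡ + ((m + k) C (m + ℓ)) ℚ./ 1
C-ratio m k ℓ = /1-*-/-cancel ((m + k) C k) (k C ℓ) ((m + k) C (m + ℓ)) ((m + ℓ) C m) {{C-nonZero m ℓ}} (begin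
  ((m + k) C k) * (k C ℓ)                ≡⟨ cong (_* (k C ℓ)) (C-sym m k) ⟨
  ((m + k) C m) * (k C ℓ)                ≡⟨ trinomial-revision m ℓ k ⟨
  ((m + k) C (m + ℓ)) * ((m + ℓ) C m)    ∎)

sumℚ-cong : ∀ L {f g : ℕ → ℚ} → (∀ i → f i ≡ g i) → sumℚ L f ≡ sumℚ L g
sumℚ-cong zero    f≡g = refl
sumℚ-cong (suc L) f≡g = cong₂ ℚ._+_ (sumℚ-cong L f≡g) (f≡g L)

*-distribˡ-sumℚ : ∀ L c (f : ℕ → ℚ) → c ℚ.* sumℚ L f ≡ sumℚ L (λ i → c ℚ.* f i)
*-distribˡ-sumℚ zero    c f = ℚ.*-zeroʳ c
*-distribˡ-sumℚ (suc L) c f =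
  trans (ℚ.*-distribˡ-+ c (sumℚ L f) (f L)) (cong (ℚ._+ c ℚ.* f L) (*-distribˡ-sumℚ L c f))

sumℚ-/1 : ∀ L (g : ℕ → ℤ) → sumℚ L (λ i → g i ℚ./ 1) ≡ sumℤ L g ℚ./ 1
sumℚ-/1 zero    g = refl
sumℚ-/1 (suc L) g = trans (cong (ℚ._+ g L ℚ./ 1) (sumℚ-/1 L g)) (sym (/1-homo-+ (sumℤ L g) (g L)))

first-identity : ∀ {n} m k → 0 < m → m + k ≡ n →
  (+ S n k) ℚ./ 1
  ≡ ((+ (n C k)) ℚ./ 1) ℚ.*
    sumℚ m (λ j →
      (sgn (+ suc j) ℚ./ 1) ℚ.* ratio k (suc j) m ℚ.*
      (sumℤ (suc (suc j)) (λ i → sgn (+ i) ℤ.* + ((m + suc j) C (suc j ∸ i)) ℤ.* + S (m + i) i) ℚ./ 1))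
first-identity m k 0<m refl = sym (begin
  (+ ((m + k) C k) ℚ./ 1) ℚ.* sumℚ m (λ j → (σ j ℚ./ 1) ℚ.* ratio k (suc j) m ℚ.* (Y j ℚ./ 1))
    ≡⟨ *-distribˡ-sumℚ m (+ ((m + k) C k) ℚ./ 1) _ ⟩
  sumℚ m (λ j → (+ ((m + k) C k) ℚ./ 1) ℚ.* ((σ j ℚ./ 1) ℚ.* ratio k (suc j) m ℚ.* (Y j ℚ./ 1)))
    ≡⟨ sumℚ-cong m in-ℤ ⟩
  sumℚ m (λ j → (+ ((m + k) C (m + suc j)) ℤ.* (σ j ℤ.* Y j)) ℚ./ 1)
    ≡⟨ sumℚ-/1 m (λ j → + ((m + k) C (m + suc j)) ℤ.* (σ j ℤ.* Y j)) ⟩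
  sumℤ m (λ j → + ((m + k) C (m + suc j)) ℤ.* (σ j ℤ.* Y j)) ℚ./ 1
    ≡⟨ cong (ℚ._/ 1) (sumℤ-cong m (λ j _ → cong (+ ((m + k) C (m + suc j)) ℤ.*_) (S₂-via-S m (suc j)))) ⟩
  sumℤ m (λ j → + ((m + k) C (m + suc j)) ℤ.* + S₂ m (suc j)) ℚ./ 1
    ≡⟨ cong (ℚ._/ 1) (S-via-S₂ m k 0<m) ⟨
  + S (m + k) k ℚ./ 1 ∎)
  where
  σ Y : ℕ → ℤ
  σ j = -1ℤ ℤ.^ suc j
  Y j = sumℤ (suc (suc j)) (λ i → -1ℤ ℤ.^ i ℤ.* + ((m + suc j) C (suc j ∸ i)) ℤ.* + S (m + i) i)
  regroup : ∀ c s r y → c ℚ.* (s ℚ.* r ℚ.* y) ≡ (c ℚ.* r) ℚ.* (s ℚ.* y)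
  regroup = solve 4 (λ c s r y → c :* (s :* r :* y) := (c :* r) :* (s :* y)) refl
    where open +-*-Solver
  in-ℤ : ∀ j → (+ ((m + k) C k) ℚ./ 1) ℚ.* ((σ j ℚ./ 1) ℚ.* ratio k (suc j) m ℚ.* (Y j ℚ./ 1))
             ≡ (+ ((m + k) C (m + suc j)) ℤ.* (σ j ℤ.* Y j)) ℚ./ 1
  in-ℤ j = begin
    (+ ((m + k) C k) ℚ./ 1) ℚ.* ((σ j ℚ./ 1) ℚ.* ratio k (suc j) m ℚ.* (Y j ℚ./ 1))
      ≡⟨ regroup (+ ((m + k) C k) ℚ./ 1) (σ j ℚ./ 1) (ratio k (suc j) m) (Y j ℚ./ 1) ⟩
    ((+ ((m + k) C k) ℚ./ 1) ℚ.* ratio k (suc j) m) ℚ.* ((σ j ℚ./ 1) ℚ.* (Y j ℚ./ 1))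
      ≡⟨ cong₂ ℚ._*_ (C-ratio m k (suc j)) (sym (/1-homo-* (σ j) (Y j))) ⟩
    (+ ((m + k) C (m + suc j)) ℚ./ 1) ℚ.* ((σ j ℤ.* Y j) ℚ./ 1)
      ≡⟨ /1-homo-* (+ ((m + k) C (m + suc j))) (σ j ℤ.* Y j) ⟨
    (+ ((m + k) C (m + suc j)) ℤ.* (σ j ℤ.* Y j)) ℚ./ 1 ∎

-- The second identity

S-via-extrapolation : ∀ M d → 0 < M →
  + S (M + (M + suc d)) (M + suc d)
  ≡ -1ℤ ℤ.^ (M + (M + suc d)) ℤ.*
    sumℤ M (λ j → -1ℤ ℤ.^ (suc d + j) ℤ.* + ((M + (M + suc d)) C (suc d + j)) ℤ.* + ((d + j) C d)
                    ℤ.* + S (M + (M ∸ j)) (M ∸ j))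
S-via-extrapolation M@(suc _) d _ = sym (begin
  -1ℤ ℤ.^ N ℤ.* sumℤ M (λ j → -1ℤ ℤ.^ (suc d + j) ℤ.* x j ℤ.* y j ℤ.* z j)
    ≡⟨ *-distribˡ-sumℤ M (-1ℤ ℤ.^ N) _ ⟩
  sumℤ M (λ j → -1ℤ ℤ.^ N ℤ.* (-1ℤ ℤ.^ (suc d + j) ℤ.* x j ℤ.* y j ℤ.* z j))
    ≡⟨ sumℤ-cong M (λ j _ → trans (regroup (-1ℤ ℤ.^ N) (-1ℤ ℤ.^ (suc d + j)) (x j) (y j) (z j))
                                  (cong (λ s → s ℤ.* x j ℤ.* y j ℤ.* z j) (sign j))) ⟩
  sumℤ M (λ j → -1ℤ ℤ.^ j ℤ.* x j ℤ.* y j ℤ.* z j)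
    ≡⟨ binomial-extrapolation M d (λ r → + S (M + r) r) (λ l → + S₂ M l) refl
                              (λ r r≤M → S-expansion M r (suc M) (s≤s r≤M)) ⟩
  sumℤ (suc M) term
    ≡⟨ sumℤ-tail term (ℕ.m≤m+n (suc M) (suc d)) beyond-M ⟨
  sumℤ (suc M + suc d) term
    ≡⟨ S-expansion M (M + suc d) (suc M + suc d) ℕ.≤-refl ⟨
  + S N (M + suc d) ∎)
  where
  N = M + (M + suc d)
  x y z : ℕ → ℤ
  x j = + (N C (suc d + j))
  y j = + ((d + j) C d)
  z j = + S (M + (M ∸ j)) (M ∸ j)
  term : ℕ → ℤ
  term l = + (N C (M + l)) ℤ.* + S₂ M l
  beyond-M : ∀ l → suc M ≤ l → term l ≡ 0ℤ
  beyond-M l M<l rewrite S₂-vanish M<l = ℤ.*-zeroʳ (+ (N C (M + l)))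
  sign : ∀ j → -1ℤ ℤ.^ N ℤ.* -1ℤ ℤ.^ (suc d + j) ≡ -1ℤ ℤ.^ j
  sign j = begin
    -1ℤ ℤ.^ N ℤ.* -1ℤ ℤ.^ (suc d + j)         ≡⟨ ℤ.^-distribˡ-+-* -1ℤ N (suc d + j) ⟨
    -1ℤ ℤ.^ (N + (suc d + j))                 ≡⟨ cong (-1ℤ ℤ.^_) (double M (suc d) j) ⟩
    -1ℤ ℤ.^ ((M + suc d) + (M + suc d) + j)   ≡⟨ ℤ.^-distribˡ-+-* -1ℤ ((M + suc d) + (M + suc d)) j ⟩
    -1ℤ ℤ.^ ((M + suc d) + (M + suc d)) ℤ.* -1ℤ ℤ.^ j ≡⟨ cong (ℤ._* -1ℤ ℤ.^ j) (-1^[n+n]≡1 (M + suc d)) ⟩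
    1ℤ ℤ.* -1ℤ ℤ.^ j                          ≡⟨ ℤ.*-identityˡ (-1ℤ ℤ.^ j) ⟩
    -1ℤ ℤ.^ j                                 ∎
    where
    double : ∀ M e j → M + (M + e) + (e + j) ≡ (M + e) + (M + e) + j
    double = ℕ-Solver.solve-∀
  regroup : ∀ s σ x y z → s ℤ.* (σ ℤ.* x ℤ.* y ℤ.* z) ≡ s ℤ.* σ ℤ.* x ℤ.* y ℤ.* z
  regroup = solve-∀

2k-n≡k-m : ∀ m k → (+ 2) ℤ.* + k ℤ.- + (m + k) ≡ + k ℤ.- + m
2k-n≡k-m m k = trans (cong (λ x → (+ 2) ℤ.* + k ℤ.- x) (ℤ.pos-+ m k)) (rearrange (+ m) (+ k))
  where
  rearrange : ∀ m k → (+ 2) ℤ.* k ℤ.- (m ℤ.+ k) ≡ k ℤ.- m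
  rearrange = solve-∀

range-length : ∀ m k → ℤ.∣ (+ k ℤ.- + 1) ℤ.- ((+ 2) ℤ.* + k ℤ.- + (m + k)) ℤ.+ + 1 ∣ ≡ m
range-length m k =
  trans (cong (λ a → ℤ.∣ (+ k ℤ.- + 1) ℤ.- a ℤ.+ + 1 ∣) (2k-n≡k-m m k)) (cong ℤ.∣_∣ (rearrange (+ m) (+ k)))
  where
  rearrange : ∀ m k → (k ℤ.- + 1) ℤ.- (k ℤ.- m) ℤ.+ + 1 ≡ m
  rearrange = solve-∀

stirling-term : ℕ → ℕ → ℤ → ℤ → ℤ
stirling-term n k L i =
  sgn i ℤ.* binomℤ (+ n) i ℤ.* binomℤ (i ℤ.- + 1) L ℤ.* + S ℤ.∣ + n ℤ.- i ∣ ℤ.∣ + k ℤ.- i ∣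

stirling-term-neg : ∀ n k L q → stirling-term n k L -[1+ q ] ≡ 0ℤ
stirling-term-neg n k L q =
  annihilate (sgn -[1+ q ]) (binomℤ (-[1+ q ] ℤ.- + 1) L) (+ S ℤ.∣ + n ℤ.- -[1+ q ] ∣ ℤ.∣ + k ℤ.- -[1+ q ] ∣)
  where
  annihilate : ∀ s x y → s ℤ.* 0ℤ ℤ.* x ℤ.* y ≡ 0ℤ
  annihilate = solve-∀

stirling-term-beyond : ∀ n k e q → stirling-term n k -[1+ e ] (+ suc q) ≡ 0ℤ
stirling-term-beyond n k e q =
  annihilate (sgn (+ suc q)) (binomℤ (+ n) (+ suc q)) (+ S ℤ.∣ + n ℤ.- + suc q ∣ ℤ.∣ + k ℤ.- + suc q ∣)
  where
  annihilate : ∀ s x y → s ℤ.* x ℤ.* 0ℤ ℤ.* y ≡ 0ℤ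
  annihilate = solve-∀

stirling-term-zero : ∀ n k e → stirling-term n k -[1+ e ] 0ℤ ≡ -1ℤ ℤ.^ e ℤ.* + S n k
stirling-term-zero n k e = begin
  1ℤ ℤ.* 1ℤ ℤ.* (-1ℤ ℤ.^ e ℤ.* + (e C e)) ℤ.* + S (n + 0) (k + 0)
    ≡⟨ cong₂ (λ c s → 1ℤ ℤ.* 1ℤ ℤ.* (-1ℤ ℤ.^ e ℤ.* + c) ℤ.* + s)
             (nCn≡1 e) (cong₂ S (ℕ.+-identityʳ n) (ℕ.+-identityʳ k)) ⟩
  1ℤ ℤ.* 1ℤ ℤ.* (-1ℤ ℤ.^ e ℤ.* 1ℤ) ℤ.* + S n k
    ≡⟨ simplify (-1ℤ ℤ.^ e) (+ S n k) ⟩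
  -1ℤ ℤ.^ e ℤ.* + S n k ∎
  where
  simplify : ∀ s x → 1ℤ ℤ.* 1ℤ ℤ.* (s ℤ.* 1ℤ) ℤ.* x ≡ s ℤ.* x
  simplify = solve-∀

stirling-term-pos : ∀ n k L t → t ≤ k → k ≤ n →
  stirling-term n k L (+ t) ≡ -1ℤ ℤ.^ t ℤ.* + (n C t) ℤ.* binomℤ (+ t ℤ.- + 1) L ℤ.* + S (n ∸ t) (k ∸ t)
stirling-term-pos n k L t t≤k k≤n =
  cong₂ (λ x y → -1ℤ ℤ.^ t ℤ.* + (n C t) ℤ.* binomℤ (+ t ℤ.- + 1) L ℤ.* + S x y)
        (∣+m-+n∣≡m∸n (ℕ.≤-trans t≤k k≤n)) (∣+m-+n∣≡m∸n t≤k)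

stirling-term-below : ∀ n k L {e} j → j < e → stirling-term n k L (ℤ.- + e ℤ.+ + j) ≡ 0ℤ
stirling-term-below n k L j j<e with ℕ.m≤n⇒∃[o]m+o≡n j<e
... | q , refl = trans (cong (stirling-term n k L) (index j q)) (stirling-term-neg n k L q)
  where
  index : ∀ j q → ℤ.- + (suc j + q) ℤ.+ + j ≡ -[1+ q ]
  index j q = trans (cong (λ x → ℤ.- x ℤ.+ + j) (ℤ.pos-+ (suc j) q)) (cancel (+ j) (+ q))
    where
    cancel : ∀ j q → ℤ.- (+ 1 ℤ.+ j ℤ.+ q) ℤ.+ j ≡ ℤ.- (+ 1 ℤ.+ q)
    cancel = solve-∀

stirling-term-diagonal : ∀ n k e → 0 < n →
  sumℤ k (λ t → stirling-term n k -[1+ e ] (ℤ.- + e ℤ.+ + (e + t))) ≡ -1ℤ ℤ.^ e ℤ.* + S n k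
stirling-term-diagonal (suc n) zero    e _ = sym (ℤ.*-zeroʳ (-1ℤ ℤ.^ e))
stirling-term-diagonal n       (suc k) e _ = begin
  sumℤ (suc k) (λ t → f (e + t))                         ≡⟨ sumℤ-suc k (λ t → f (e + t)) ⟩
  f (e + 0) ℤ.+ sumℤ k (λ t → f (e + suc t))             ≡⟨ cong₂ ℤ._+_ diagonal (sumℤ-zero k (λ t _ → beyond t)) ⟩
  -1ℤ ℤ.^ e ℤ.* + S n (suc k) ℤ.+ 0ℤ                     ≡⟨ ℤ.+-identityʳ _ ⟩
  -1ℤ ℤ.^ e ℤ.* + S n (suc k)                            ∎
  where
  f : ℕ → ℤ
  f j = stirling-term n (suc k) -[1+ e ] (ℤ.- + e ℤ.+ + j)
  diagonal : f (e + 0) ≡ -1ℤ ℤ.^ e ℤ.* + S n (suc k)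
  diagonal = trans (cong (stirling-term n (suc k) -[1+ e ]) (-+m++[m+n]≡+n e 0)) (stirling-term-zero n (suc k) e)
  beyond : ∀ t → f (e + suc t) ≡ 0ℤ
  beyond t = trans (cong (stirling-term n (suc k) -[1+ e ]) (-+m++[m+n]≡+n e (suc t))) (stirling-term-beyond n (suc k) e t)

second-identity-2k>n : ∀ m d → 0 < m →
  + S (m + (m + suc d)) (m + suc d)
  ≡ -1ℤ ℤ.^ (m + (m + suc d)) ℤ.*
    sumℤ m (λ j → stirling-term (m + (m + suc d)) (m + suc d)
                    ((+ 2) ℤ.* + (m + suc d) ℤ.- + (m + (m + suc d)) ℤ.- + 1)
                    ((+ 2) ℤ.* + (m + suc d) ℤ.- + (m + (m + suc d)) ℤ.+ + j))
second-identity-2k>n m d 0<m rewrite 2k-n≡k-m m (m + suc d) | +[m+n]-+m≡+n m (suc d) =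
  trans (S-via-extrapolation m d 0<m) (cong (-1ℤ ℤ.^ n ℤ.*_) (sumℤ-cong m (λ j j<m → sym (term j j<m))))
  where
  k = m + suc d
  n = m + k
  term : ∀ j → j < m → stirling-term n k (+ d) (+ (suc d + j))
                       ≡ -1ℤ ℤ.^ (suc d + j) ℤ.* + (n C (suc d + j)) ℤ.* + ((d + j) C d) ℤ.* + S (m + (m ∸ j)) (m ∸ j)
  term j j<m = trans (stirling-term-pos n k (+ d) (suc d + j) t≤k (ℕ.m≤n+m k m))
                     (cong₂ (λ x y → -1ℤ ℤ.^ (suc d + j) ℤ.* + (n C (suc d + j)) ℤ.* + ((d + j) C d) ℤ.* + S x y) n-t k-t)
    where
    k-t : k ∸ (suc d + j) ≡ m ∸ j
    k-t = trans (cong (_∸ (suc d + j)) (ℕ.+-comm m (suc d))) (ℕ.[m+n]∸[m+o]≡n∸o (suc d) m j)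
    t≤k : suc d + j ≤ k
    t≤k = subst (suc d + j ≤_) (ℕ.+-comm (suc d) m) (ℕ.+-monoʳ-≤ (suc d) (ℕ.<⇒≤ j<m))
    n-t : n ∸ (suc d + j) ≡ m + (m ∸ j)
    n-t = trans (ℕ.+-∸-assoc m t≤k) (cong (_+_ m) k-t)

-- Only i = 0 contributes: binomℤ (+ n) i vanishes for i < 0, and binomℤ (i - 1) (2k - n - 1) for i > 0.
second-identity-2k≤n : ∀ k e → 0 < k + e →
  + S (k + e + k) k
  ≡ -1ℤ ℤ.^ (k + e + k) ℤ.*
    sumℤ (k + e) (λ j → stirling-term (k + e + k) k
                          ((+ 2) ℤ.* + k ℤ.- + (k + e + k) ℤ.- + 1)
                          ((+ 2) ℤ.* + k ℤ.- + (k + e + k) ℤ.+ + j))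
second-identity-2k≤n k e 0<k+e
  rewrite 2k-n≡k-m (k + e) k | +m-+[m+n]≡-+n k e | -+n-1≡-[1+n] e = sym (begin
  -1ℤ ℤ.^ n ℤ.* sumℤ (k + e) f
    ≡⟨ cong (λ L → -1ℤ ℤ.^ n ℤ.* sumℤ L f) (ℕ.+-comm k e) ⟩
  -1ℤ ℤ.^ n ℤ.* sumℤ (e + k) f
    ≡⟨ cong (-1ℤ ℤ.^ n ℤ.*_) (sumℤ-+ e k f) ⟩
  -1ℤ ℤ.^ n ℤ.* (sumℤ e f ℤ.+ sumℤ k (λ t → f (e + t)))
    ≡⟨ cong₂ (λ x y → -1ℤ ℤ.^ n ℤ.* (x ℤ.+ y)) (sumℤ-zero e (stirling-term-below n k -[1+ e ]))
                                               (stirling-term-diagonal n k e (ℕ.<-≤-trans 0<k+e (ℕ.m≤m+n (k + e) k))) ⟩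
  -1ℤ ℤ.^ n ℤ.* (0ℤ ℤ.+ -1ℤ ℤ.^ e ℤ.* + S n k)
    ≡⟨ cong (-1ℤ ℤ.^ n ℤ.*_) (ℤ.+-identityˡ (-1ℤ ℤ.^ e ℤ.* + S n k)) ⟩
  -1ℤ ℤ.^ n ℤ.* (-1ℤ ℤ.^ e ℤ.* + S n k)
    ≡⟨ cancel-unit (-1ℤ ℤ.^ n) (-1ℤ ℤ.^ e) (+ S n k) sign ⟩
  + S n k ∎)
  where
  n = k + e + k
  f : ℕ → ℤ
  f j = stirling-term n k -[1+ e ] (ℤ.- + e ℤ.+ + j)
  sign : -1ℤ ℤ.^ n ℤ.* -1ℤ ℤ.^ e ≡ 1ℤ
  sign = begin
    -1ℤ ℤ.^ n ℤ.* -1ℤ ℤ.^ e             ≡⟨ ℤ.^-distribˡ-+-* -1ℤ n e ⟨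
    -1ℤ ℤ.^ (n + e)                     ≡⟨ cong (-1ℤ ℤ.^_) (double k e) ⟩
    -1ℤ ℤ.^ ((k + e) + (k + e))         ≡⟨ -1^[n+n]≡1 (k + e) ⟩
    1ℤ                                  ∎
    where
    double : ∀ k e → k + e + k + e ≡ (k + e) + (k + e)
    double = ℕ-Solver.solve-∀

second-identity-reindexed : ∀ m k → 0 < m →
  + S (m + k) k
  ≡ -1ℤ ℤ.^ (m + k) ℤ.*
    sumℤ m (λ j → stirling-term (m + k) k ((+ 2) ℤ.* + k ℤ.- + (m + k) ℤ.- + 1) ((+ 2) ℤ.* + k ℤ.- + (m + k) ℤ.+ + j))
second-identity-reindexed m k 0<m with k ℕ.≤? m
... | yes k≤m with ℕ.m≤n⇒∃[o]m+o≡n k≤m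
...   | e , refl = second-identity-2k≤n k e 0<m
second-identity-reindexed m k 0<m | no k≰m with ℕ.m≤n⇒∃[o]m+o≡n (ℕ.≰⇒> k≰m)
...   | d , 1+m+d≡k with trans (ℕ.+-suc m d) 1+m+d≡k
...     | refl = second-identity-2k>n m d 0<m

second-identity : ∀ {n} m k → 0 < m → m + k ≡ n →
  + S n k
  ≡ sgn (+ n) ℤ.* sumℤ-range ((+ 2) ℤ.* (+ k) ℤ.- + n) (+ k ℤ.- + 1) (stirling-term n k ((+ 2) ℤ.* (+ k) ℤ.- + n ℤ.- + 1))
second-identity m k 0<m refl =
  trans (second-identity-reindexed m k 0<m) (cong (λ L → -1ℤ ℤ.^ (m + k) ℤ.* sumℤ L term) (sym (range-length m k)))
  where
  a = (+ 2) ℤ.* + k ℤ.- + (m + k)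
  term : ℕ → ℤ
  term j = stirling-term (m + k) k (a ℤ.- + 1) (a ℤ.+ + j)

theorem2p1 : ∀ (n k : ℕ) → k < n →
    ((+ S n k) ℚ./ 1
      ≡ ((+ (n C k)) ℚ./ 1) ℚ.*
        sumℚ (n ∸ k) (λ j →
          (sgn (+ suc j) ℚ./ 1) ℚ.* ratio k (suc j) (n ∸ k) ℚ.*
          (sumℤ (suc (suc j)) (λ i →
             sgn (+ i) ℤ.* + (((n ∸ k) Data.Nat.+ suc j) C (suc j ∸ i))
               ℤ.* + S ((n ∸ k) Data.Nat.+ i) i) ℚ./ 1)))
    × (+ S n k
      ≡ sgn (+ n) ℤ.*
        sumℤ-range ((+ 2) ℤ.* (+ k) ℤ.- + n) (+ k ℤ.- + 1) (λ i →
          sgn i ℤ.* binomℤ (+ n) i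
            ℤ.* binomℤ (i ℤ.- + 1) ((+ 2) ℤ.* (+ k) ℤ.- + n ℤ.- + 1)
            ℤ.* + S ℤ.∣ + n ℤ.- i ∣ ℤ.∣ + k ℤ.- i ∣))
theorem2p1 n k k<n = first-identity m k 0<m m+k≡n , second-identity m k 0<m m+k≡n
  where
  m = n ∸ k
  0<m = ℕ.m<n⇒0<n∸m k<n
  m+k≡n = ℕ.m∸n+n≡m (ℕ.<⇒≤ k<n)
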